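{- Let $M$ be a matroid on a finite set $E$. If there exists a partition $P$ of $\bigcup\mathcal{B}(M)$ such that $|B\cap K|=1$ for every $B\in\mathcal{B}(M)$ and every $K\in P$, then $|\mathcal{B}(M)|=\prod_{K\in P}|K|$.
   Context: $\mathcal{B}(M)$ is the family of bases of $M$. A partition of a set $S$ is a family of nonempty pairwise disjoint subsets of $S$ with union $S$. -}

module Defs where

open import Data.Nat using (ℕ; zero; suc)
open import Data.Bool using (Bool; true; false)
open import Data.Fin using (Fin)
open import Data.Fin.Subset using (Subset; _∈_; _∉_; _∪_; _∩_; _-_; ⁅_⁆; ∣_∣; Nonempty; Empty; inside; outside)
open import Data.Vec using (Vec; []; _∷_)
open import Data.List using (List; []; _∷_; _++_; map; filter; length; lookup)
open import Data.Product using (Σ; ∃; _×_; _,_)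
open import Function.Bundles using (_⇔_)
open import Relation.Binary.PropositionalEquality using (_≡_; _≢_)
open import Relation.Nullary using (¬_)
open import Data.Bool.Properties using (_≟_)

allSubsets : (n : ℕ) → List (Subset n)
allSubsets zero = [] ∷ []
allSubsets (suc n) = map (inside ∷_) (allSubsets n) ++ map (outside ∷_) (allSubsets n)

record Matroid (n : ℕ) : Set where
  field
    isBasis  : Subset n → Bool
    nonempty : ∃ λ B → isBasis B ≡ true
    exchange : ∀ B₁ B₂ → isBasis B₁ ≡ true → isBasis B₂ ≡ true →
               ∀ x → x ∈ B₁ → x ∉ B₂ →
               ∃ λ y → y ∈ B₂ × y ∉ B₁ × isBasis ((B₁ - x) ∪ ⁅ y ⁆) ≡ true

open Matroid public

IsBase : ∀ {n} → Matroid n → Subset n → Set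
IsBase M B = isBasis M B ≡ true

bases : ∀ {n} → Matroid n → List (Subset n)
bases {n} M = filter (λ B → isBasis M B ≟ true) (allSubsets n)

numBases : ∀ {n} → Matroid n → ℕ
numBases M = length (bases M)

InUnionBases : ∀ {n} → Matroid n → Fin n → Set
InUnionBases M x = ∃ λ B → IsBase M B × x ∈ B

IsPartitionOf : ∀ {n} → (Fin n → Set) → List (Subset n) → Set
IsPartitionOf {n} S P =
  (∀ i → Nonempty (lookup P i)) ×
  (∀ i j → i ≢ j → Empty (lookup P i ∩ lookup P j)) ×
  (∀ (x : Fin n) → (∃ λ i → x ∈ lookup P i) ⇔ S x)

-- Every base is a transversal of P: a subset of ⋃ P meeting each block exactly once. Conversely,
-- a base B can be pushed towards any transversal T by basis exchange: for x ∈ B ∖ T, exchanging x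
-- against the element t of T in the block of x (using a base through t) yields the base B - x + t,
-- because the new element must land in the block that B - x no longer meets. Hence the bases are
-- exactly the transversals. Adjoining ∁ ⋃ P as a block with target 0, transversals become the
-- subsets S with ∣ S ∩ K ∣ = t_K for the blocks K of a partition of the ground set, and those are
-- counted by ∏ C(∣ K ∣, t_K): peel off the first point and apply Pascal's rule to its block.

module Submission where

open import Defs
open import Data.Nat using (ℕ; zero; suc; _+_; _*_; _<_; s≤s)
open import Data.Nat.Properties using (*-distribʳ-+; *-distribˡ-+; *-identityˡ; suc-injective; <-irrefl; n<1+n)
open import Data.Nat.Combinatorics using (_C_; nC1≡n; k>n⇒nCk≡0; nCk+nC[k+1]≡[n+1]C[k+1])
open import Data.Nat.Induction using (<-wellFounded)
open import Data.Nat.ListAction using (product)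
open import Data.Bool using (true; false)
open import Data.Fin using (Fin; zero; suc)
open import Data.Fin.Subset using (Subset; _∈_; _∉_; _⊆_; _⊂_; _∩_; _∪_; _─_; _-_; ⁅_⁆; ∁; ⋃; ∣_∣; Nonempty; Empty; inside; outside)
open import Data.Fin.Subset.Properties
  using (_∈?_; nonempty?; ⊆-antisym; Empty-unique; ∣⊥∣≡0; ∉⊥; x∈p∩q⁺; x∈p∩q⁻; x∈p∪q⁺; x∈p∪q⁻; x∈⁅x⁆; x∈⁅y⁆⇒x≡y;
         x∈p∧x∉q⇒x∈p─q; p─q⊆p; ∣p∩q∣≤∣q∣; p⊂q⇒∣p∣<∣q∣; x∈p⇒x∉∁p; x∉∁p⇒x∈p; x∉p⇒x∈∁p)
open import Data.Vec using (_∷_; []; tail; here; there)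
open import Data.List using (List; []; _∷_; _++_; map; filter; length; lookup)
open import Data.List.Properties using (filter-++; length-++; filter-≐; filter-all; filter-none; tabulate-lookup; map-∘; map-cong)
open import Data.List.Relation.Unary.All as All using (All; []; _∷_; all?)
open import Data.List.Relation.Unary.All.Properties using (tabulate⁺; tabulate⁻) renaming (map⁺ to All-map⁺; map⁻ to All-map⁻)
open import Data.Product using (∃; _×_; _,_; proj₁; proj₂)
open import Data.Sum using (inj₁; inj₂)
open import Data.Empty using (⊥-elim)
open import Function using (_∘_)
open import Function.Bundles using (_⇔_; mk⇔; Equivalence)
open import Induction.WellFounded using (Acc; acc)
open import Relation.Binary.PropositionalEquality using (_≡_; _≢_; refl; sym; trans; cong; cong₂; subst; module ≡-Reasoning)
open import Relation.Nullary using (¬_; yes; no; does; contradiction)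
open import Relation.Unary using (Pred; Decidable; _≐_)
open import Level using (0ℓ)
import Data.Nat as ℕ
import Data.Fin.Properties as Fin

open ≡-Reasoning

numSubsetsWith : ∀ {n} {P : Pred (Subset n) 0ℓ} → Decidable P → ℕ
numSubsetsWith {n} P? = length (filter P? (allSubsets n))

module _ {n} {P Q : Pred (Subset n) 0ℓ} (P? : Decidable P) (Q? : Decidable Q) where

  numSubsetsWith-≐ : P ≐ Q → numSubsetsWith P? ≡ numSubsetsWith Q?
  numSubsetsWith-≐ P≐Q = cong length (filter-≐ P? Q? P≐Q (allSubsets n))

module _ {n} {P : Pred (Subset n) 0ℓ} (P? : Decidable P) where

  numSubsetsWith-none : (∀ S → ¬ P S) → numSubsetsWith P? ≡ 0
  numSubsetsWith-none ¬P = cong length (filter-none P? (All.universal ¬P (allSubsets n)))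

  numSubsetsWith-all : (∀ S → P S) → numSubsetsWith P? ≡ length (allSubsets n)
  numSubsetsWith-all p = cong length (filter-all P? (All.universal p (allSubsets n)))

length-filter-map : ∀ {A B : Set} {P : Pred B 0ℓ} (P? : Decidable P) (f : A → B) xs →
                    length (filter P? (map f xs)) ≡ length (filter (P? ∘ f) xs)
length-filter-map P? f []       = refl
length-filter-map P? f (x ∷ xs) with does (P? (f x))
... | true  = cong suc (length-filter-map P? f xs)
... | false = length-filter-map P? f xs

numSubsetsWith-suc : ∀ {n} {P : Pred (Subset (suc n)) 0ℓ} (P? : Decidable P) →
  numSubsetsWith P? ≡ numSubsetsWith (P? ∘ (inside ∷_)) + numSubsetsWith (P? ∘ (outside ∷_))
numSubsetsWith-suc {n} P? = begin
  length (filter P? (map (inside ∷_) Ss ++ map (outside ∷_) Ss))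
    ≡⟨ cong length (filter-++ P? (map (inside ∷_) Ss) (map (outside ∷_) Ss)) ⟩
  length (filter P? (map (inside ∷_) Ss) ++ filter P? (map (outside ∷_) Ss))
    ≡⟨ length-++ (filter P? (map (inside ∷_) Ss)) ⟩
  length (filter P? (map (inside ∷_) Ss)) + length (filter P? (map (outside ∷_) Ss))
    ≡⟨ cong₂ _+_ (length-filter-map P? (inside ∷_) Ss) (length-filter-map P? (outside ∷_) Ss) ⟩
  numSubsetsWith (P? ∘ (inside ∷_)) + numSubsetsWith (P? ∘ (outside ∷_)) ∎
  where Ss = allSubsets n

data ExactlyOne {A : Set} (P : Pred A 0ℓ) : Pred (List A) 0ℓ where
  this : ∀ {x xs} → P x → All (¬_ ∘ P) xs → ExactlyOne P (x ∷ xs)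
  next : ∀ {x xs} → ¬ P x → ExactlyOne P xs → ExactlyOne P (x ∷ xs)

module _ {A : Set} {P Q : Pred A 0ℓ} where

  ExactlyOne-≐ : P ≐ Q → ∀ {xs} → ExactlyOne P xs → ExactlyOne Q xs
  ExactlyOne-≐ (P⊆Q , Q⊆P) (this px ¬Pxs) = this (P⊆Q px) (All.map (_∘ Q⊆P) ¬Pxs)
  ExactlyOne-≐ (P⊆Q , Q⊆P) (next ¬px one) = next (¬px ∘ Q⊆P) (ExactlyOne-≐ (P⊆Q , Q⊆P) one)

ExactlyOne-map⁺ : ∀ {A B : Set} {P : Pred B 0ℓ} (f : A → B) {xs} →
                  ExactlyOne (P ∘ f) xs → ExactlyOne P (map f xs)
ExactlyOne-map⁺ f (this px ¬Pxs) = this px (All-map⁺ ¬Pxs)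
ExactlyOne-map⁺ f (next ¬px one) = next ¬px (ExactlyOne-map⁺ f one)

Constraint : ℕ → Set
Constraint n = Subset n × ℕ

_satisfies_ : ∀ {n} → Subset n → Constraint n → Set
S satisfies (K , t) = ∣ S ∩ K ∣ ≡ t

SatisfiesAll : ∀ {n} → List (Constraint n) → Pred (Subset n) 0ℓ
SatisfiesAll Q S = All (S satisfies_) Q

satisfiesAll? : ∀ {n} (Q : List (Constraint n)) → Decidable (SatisfiesAll Q)
satisfiesAll? Q S = all? (λ (K , t) → ∣ S ∩ K ∣ ℕ.≟ t) Q

weight : ∀ {n} → Constraint n → ℕ
weight (K , t) = ∣ K ∣ C t

-- Blocks may be empty.
IsBlockPartition : ∀ {n} → List (Constraint n) → Set
IsBlockPartition Q = ∀ x → ExactlyOne (λ (K , _) → x ∈ K) Q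

numSubsetsWith-satisfiesAll₀ : (Q : List (Constraint 0)) →
  numSubsetsWith (satisfiesAll? Q) ≡ product (map weight Q)
numSubsetsWith-satisfiesAll₀ [] = numSubsetsWith-all (satisfiesAll? {0} []) (λ _ → [])
numSubsetsWith-satisfiesAll₀ (([] , zero) ∷ Q) = begin
  numSubsetsWith (satisfiesAll? (([] , 0) ∷ Q))
    ≡⟨ numSubsetsWith-≐ (satisfiesAll? (([] , 0) ∷ Q)) (satisfiesAll? Q) (All.tail , λ { {[]} sat → refl ∷ sat }) ⟩
  numSubsetsWith (satisfiesAll? Q)
    ≡⟨ numSubsetsWith-satisfiesAll₀ Q ⟩
  product (map weight Q)
    ≡⟨ *-identityˡ _ ⟨
  1 * product (map weight Q) ∎
numSubsetsWith-satisfiesAll₀ (([] , suc t) ∷ Q) =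
  numSubsetsWith-none (satisfiesAll? (([] , suc t) ∷ Q)) λ { [] (() ∷ _) }

-- dropFirst q (resp. takeFirst q) is what S must satisfy for outside ∷ S (resp. inside ∷ S)
-- to satisfy q. If 0 ∈ K but the target is 0, no S works; the unreachable target suc ∣ K ∣
-- records this.
dropFirst : ∀ {n} → Constraint (suc n) → Constraint n
dropFirst (K , t) = tail K , t

takeFirst : ∀ {n} → Constraint (suc n) → Constraint n
takeFirst (outside ∷ K , t)     = K , t
takeFirst (inside  ∷ K , zero)  = K , suc ∣ K ∣
takeFirst (inside  ∷ K , suc t) = K , t

takeFirst-block : ∀ {n} (q : Constraint (suc n)) → proj₁ (takeFirst q) ≡ tail (proj₁ q)
takeFirst-block (outside ∷ K , t)     = refl
takeFirst-block (inside  ∷ K , zero)  = refl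
takeFirst-block (inside  ∷ K , suc t) = refl

module _ {n} (S : Subset n) where

  satisfies-dropFirst : ∀ q → (outside ∷ S) satisfies q ⇔ S satisfies dropFirst q
  satisfies-dropFirst (_ ∷ K , t) = mk⇔ (λ sat → sat) (λ sat → sat)

  satisfies-takeFirst : ∀ q → (inside ∷ S) satisfies q ⇔ S satisfies takeFirst q
  satisfies-takeFirst (outside ∷ K , t)     = mk⇔ (λ sat → sat) (λ sat → sat)
  satisfies-takeFirst (inside  ∷ K , zero)  = mk⇔ (λ ()) λ sat → ⊥-elim (<-irrefl sat (s≤s (∣p∩q∣≤∣q∣ S K)))
  satisfies-takeFirst (inside  ∷ K , suc t) = mk⇔ suc-injective (cong suc)

SatisfiesAll-step : ∀ {n} b (f : Constraint (suc n) → Constraint n) →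
  (∀ {S : Subset n} q → (b ∷ S) satisfies q ⇔ S satisfies f q) →
  ∀ Q → SatisfiesAll Q ∘ (b ∷_) ≐ SatisfiesAll (map f Q)
SatisfiesAll-step b f step Q =
  (λ sat → All-map⁺ (All.map (Equivalence.to (step _)) sat)) ,
  (λ sat → All.map (Equivalence.from (step _)) (All-map⁻ sat))

suc∈⇔∈tail : ∀ {n} {x : Fin n} (K : Subset (suc n)) → suc x ∈ K ⇔ x ∈ tail K
suc∈⇔∈tail (_ ∷ K) = mk⇔ (λ { (there x∈K) → x∈K }) there

IsBlockPartition-map : ∀ {n} (f : Constraint (suc n) → Constraint n) →
  (∀ q → proj₁ (f q) ≡ tail (proj₁ q)) →
  ∀ {Q} → IsBlockPartition Q → IsBlockPartition (map f Q)
IsBlockPartition-map f f-block part x =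
  ExactlyOne-map⁺ f (ExactlyOne-≐ (to-f , from-f) (part (suc x)))
  where
  to-f : ∀ {q} → suc x ∈ proj₁ q → x ∈ proj₁ (f q)
  to-f {q} m = subst (x ∈_) (sym (f-block q)) (Equivalence.to (suc∈⇔∈tail (proj₁ q)) m)
  from-f : ∀ {q} → x ∈ proj₁ (f q) → suc x ∈ proj₁ q
  from-f {q} m = Equivalence.from (suc∈⇔∈tail (proj₁ q)) (subst (x ∈_) (f-block q) m)

weight-takeFirst+dropFirst : ∀ {n} (q : Constraint (suc n)) → zero ∈ proj₁ q →
  weight (takeFirst q) + weight (dropFirst q) ≡ weight q
weight-takeFirst+dropFirst (inside ∷ K , zero)  here = cong (_+ 1) (k>n⇒nCk≡0 (n<1+n ∣ K ∣))
weight-takeFirst+dropFirst (inside ∷ K , suc t) here = nCk+nC[k+1]≡[n+1]C[k+1] ∣ K ∣ t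

weight-takeFirst : ∀ {n} (q : Constraint (suc n)) → zero ∉ proj₁ q → weight (takeFirst q) ≡ weight q
weight-takeFirst (outside ∷ K , t) _   = refl
weight-takeFirst (inside ∷ K , t)  0∉K = contradiction here 0∉K

weight-dropFirst : ∀ {n} (q : Constraint (suc n)) → zero ∉ proj₁ q → weight (dropFirst q) ≡ weight q
weight-dropFirst (outside ∷ K , t) _   = refl
weight-dropFirst (inside ∷ K , t)  0∉K = contradiction here 0∉K

product-weight-map : ∀ {n} (f : Constraint (suc n) → Constraint n) →
  (∀ q → zero ∉ proj₁ q → weight (f q) ≡ weight q) →
  ∀ {Q} → All (λ q → zero ∉ proj₁ q) Q → product (map weight (map f Q)) ≡ product (map weight Q)
product-weight-map f f-weight []           = refl
product-weight-map f f-weight (0∉q ∷ 0∉Q) = cong₂ _*_ (f-weight _ 0∉q) (product-weight-map f f-weight 0∉Q)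

-- Pascal's rule, applied to the unique block containing the point 0.
product-takeFirst+dropFirst : ∀ {n} {Q : List (Constraint (suc n))} →
  ExactlyOne (λ (K , _) → zero ∈ K) Q →
  product (map weight (map takeFirst Q)) + product (map weight (map dropFirst Q)) ≡ product (map weight Q)
product-takeFirst+dropFirst {Q = q ∷ Q} (this 0∈q 0∉Q) = begin
  weight (takeFirst q) * product (map weight (map takeFirst Q)) + weight (dropFirst q) * product (map weight (map dropFirst Q))
    ≡⟨ cong₂ (λ a b → weight (takeFirst q) * a + weight (dropFirst q) * b)
             (product-weight-map takeFirst weight-takeFirst 0∉Q) (product-weight-map dropFirst weight-dropFirst 0∉Q) ⟩
  weight (takeFirst q) * Π + weight (dropFirst q) * Π
    ≡⟨ *-distribʳ-+ Π (weight (takeFirst q)) (weight (dropFirst q)) ⟨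
  (weight (takeFirst q) + weight (dropFirst q)) * Π
    ≡⟨ cong (_* Π) (weight-takeFirst+dropFirst q 0∈q) ⟩
  weight q * Π ∎
  where Π = product (map weight Q)
product-takeFirst+dropFirst {Q = q ∷ Q} (next 0∉q one) = begin
  weight (takeFirst q) * Πtake + weight (dropFirst q) * Πdrop
    ≡⟨ cong₂ (λ a b → a * Πtake + b * Πdrop) (weight-takeFirst q 0∉q) (weight-dropFirst q 0∉q) ⟩
  weight q * Πtake + weight q * Πdrop
    ≡⟨ *-distribˡ-+ (weight q) Πtake Πdrop ⟨
  weight q * (Πtake + Πdrop)
    ≡⟨ cong (weight q *_) (product-takeFirst+dropFirst one) ⟩
  weight q * product (map weight Q) ∎
  where
  Πtake = product (map weight (map takeFirst Q))
  Πdrop = product (map weight (map dropFirst Q))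

numSubsetsWith-satisfiesAll : ∀ {n} (Q : List (Constraint n)) → IsBlockPartition Q →
  numSubsetsWith (satisfiesAll? Q) ≡ product (map weight Q)
numSubsetsWith-satisfiesAll {zero}  Q _    = numSubsetsWith-satisfiesAll₀ Q
numSubsetsWith-satisfiesAll {suc n} Q part = begin
  numSubsetsWith (satisfiesAll? Q)
    ≡⟨ numSubsetsWith-suc (satisfiesAll? Q) ⟩
  numSubsetsWith (satisfiesAll? Q ∘ (inside ∷_)) + numSubsetsWith (satisfiesAll? Q ∘ (outside ∷_))
    ≡⟨ cong₂ _+_
         (numSubsetsWith-≐ _ (satisfiesAll? (map takeFirst Q)) (SatisfiesAll-step inside takeFirst (satisfies-takeFirst _) Q))
         (numSubsetsWith-≐ _ (satisfiesAll? (map dropFirst Q)) (SatisfiesAll-step outside dropFirst (satisfies-dropFirst _) Q)) ⟩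
  numSubsetsWith (satisfiesAll? (map takeFirst Q)) + numSubsetsWith (satisfiesAll? (map dropFirst Q))
    ≡⟨ cong₂ _+_
         (numSubsetsWith-satisfiesAll (map takeFirst Q) (IsBlockPartition-map takeFirst takeFirst-block part))
         (numSubsetsWith-satisfiesAll (map dropFirst Q) (IsBlockPartition-map dropFirst (λ _ → refl) part)) ⟩
  product (map weight (map takeFirst Q)) + product (map weight (map dropFirst Q))
    ≡⟨ product-takeFirst+dropFirst (part zero) ⟩
  product (map weight Q) ∎

x∈p⇒∣p∣≢0 : ∀ {n} {p : Subset n} {x} → x ∈ p → ∣ p ∣ ≢ 0
x∈p⇒∣p∣≢0 {p = inside  ∷ p} _           ()
x∈p⇒∣p∣≢0 {p = outside ∷ p} (there x∈p) = x∈p⇒∣p∣≢0 x∈p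

∣p∣≡1⇒unique : ∀ {n} {p : Subset n} {x y} → ∣ p ∣ ≡ 1 → x ∈ p → y ∈ p → x ≡ y
∣p∣≡1⇒unique {p = inside ∷ p} _ here        here        = refl
∣p∣≡1⇒unique {p = inside ∷ p} e here        (there y∈p) = contradiction (cong ℕ.pred e) (x∈p⇒∣p∣≢0 y∈p)
∣p∣≡1⇒unique {p = inside ∷ p} e (there x∈p) _           = contradiction (cong ℕ.pred e) (x∈p⇒∣p∣≢0 x∈p)
∣p∣≡1⇒unique {p = outside ∷ p} e (there x∈p) (there y∈p) = cong suc (∣p∣≡1⇒unique e x∈p y∈p)

∣p∣≡1⇒nonempty : ∀ {n} {p : Subset n} → ∣ p ∣ ≡ 1 → Nonempty p
∣p∣≡1⇒nonempty {n} {p} e with nonempty? p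
... | yes ne = ne
... | no ¬ne = contradiction (trans (sym e) (trans (cong ∣_∣ (Empty-unique ¬ne)) (∣⊥∣≡0 n))) λ ()

x∈p─q⇒x∉q : ∀ {n} {p q : Subset n} {x} → x ∈ p ─ q → x ∉ q
x∈p─q⇒x∉q {p = inside ∷ p} {q = outside ∷ q} here        ()
x∈p─q⇒x∉q {p = _ ∷ p} {q = _ ∷ q} (there x∈p─q) (there x∈q) = x∈p─q⇒x∉q x∈p─q x∈q

Empty[p─q]⇒p⊆q : ∀ {n} {p q : Subset n} → Empty (p ─ q) → p ⊆ q
Empty[p─q]⇒p⊆q {p = p} {q} empty {x} x∈p with x ∈? q
... | yes x∈q = x∈q
... | no  x∉q = contradiction (x , x∈p∧x∉q⇒x∈p─q x∈p x∉q) empty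

∣p∩∁q∣≡0⇔p⊆q : ∀ {n} {p q : Subset n} → ∣ p ∩ ∁ q ∣ ≡ 0 ⇔ p ⊆ q
∣p∩∁q∣≡0⇔p⊆q {n} {p} {q} = mk⇔ to from
  where
  to : ∣ p ∩ ∁ q ∣ ≡ 0 → p ⊆ q
  to e x∈p = x∉∁p⇒x∈p λ x∈∁q → x∈p⇒∣p∣≢0 (x∈p∩q⁺ (x∈p , x∈∁q)) e
  from : p ⊆ q → ∣ p ∩ ∁ q ∣ ≡ 0
  from p⊆q = trans (cong ∣_∣ (Empty-unique empty)) (∣⊥∣≡0 n)
    where
    empty : Empty (p ∩ ∁ q)
    empty (x , x∈p∩∁q) = let x∈p , x∈∁q = x∈p∩q⁻ p (∁ q) x∈p∩∁q in x∈p⇒x∉∁p (p⊆q x∈p) x∈∁q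

∈⋃⇔∃lookup : ∀ {n} (P : List (Subset n)) {x} → x ∈ ⋃ P ⇔ (∃ λ i → x ∈ lookup P i)
∈⋃⇔∃lookup []      = mk⇔ (λ x∈⊥ → contradiction x∈⊥ ∉⊥) λ ()
∈⋃⇔∃lookup (K ∷ P) = mk⇔ to from
  where
  to : ∀ {x} → x ∈ K ∪ ⋃ P → ∃ λ i → x ∈ lookup (K ∷ P) i
  to x∈ with x∈p∪q⁻ K (⋃ P) x∈
  ... | inj₁ x∈K  = zero , x∈K
  ... | inj₂ x∈⋃P = let i , x∈Ki = Equivalence.to (∈⋃⇔∃lookup P) x∈⋃P in suc i , x∈Ki
  from : ∀ {x} → (∃ λ i → x ∈ lookup (K ∷ P) i) → x ∈ K ∪ ⋃ P
  from (zero  , x∈K)  = x∈p∪q⁺ (inj₁ x∈K)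
  from (suc i , x∈Ki) = x∈p∪q⁺ (inj₂ (Equivalence.from (∈⋃⇔∃lookup P) (i , x∈Ki)))

exchange─⊂ : ∀ {n} {B T : Subset n} {x t} → x ∈ B → x ∉ T → t ∈ T → (B - x) ∪ ⁅ t ⁆ ─ T ⊂ B ─ T
exchange─⊂ {B = B} {T} {x} {t} x∈B x∉T t∈T = ⊆ , x , x∈p∧x∉q⇒x∈p─q x∈B x∉T , x∉
  where
  ⊆ : (B - x) ∪ ⁅ t ⁆ ─ T ⊆ B ─ T
  ⊆ {z} z∈ with x∈p∪q⁻ (B - x) ⁅ t ⁆ (p─q⊆p _ T z∈)
  ... | inj₁ z∈B-x = x∈p∧x∉q⇒x∈p─q (p─q⊆p B ⁅ x ⁆ z∈B-x) (x∈p─q⇒x∉q z∈)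
  ... | inj₂ z∈⁅t⁆ = contradiction (subst (_∈ T) (sym (x∈⁅y⁆⇒x≡y t z∈⁅t⁆)) t∈T) (x∈p─q⇒x∉q z∈)
  x∉ : x ∉ (B - x) ∪ ⁅ t ⁆ ─ T
  x∉ x∈ with x∈p∪q⁻ (B - x) ⁅ t ⁆ (p─q⊆p _ T x∈)
  ... | inj₁ x∈B-x = x∈p─q⇒x∉q x∈B-x (x∈⁅x⁆ x)
  ... | inj₂ x∈⁅t⁆ = x∉T (subst (_∈ T) (sym (x∈⁅y⁆⇒x≡y t x∈⁅t⁆)) t∈T)

IsTransversal : ∀ {n} → List (Subset n) → Pred (Subset n) 0ℓ
IsTransversal P T = (∀ {x} → x ∈ T → ∃ λ i → x ∈ lookup P i) × (∀ i → ∣ T ∩ lookup P i ∣ ≡ 1)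

module _ {n} (M : Matroid n) (P : List (Subset n))
         (cover : ∀ x → (∃ λ i → x ∈ lookup P i) ⇔ InUnionBases M x)
         (base-meets-once : ∀ B i → IsBase M B → ∣ B ∩ lookup P i ∣ ≡ 1) where

  base-block-unique : ∀ {B x y} i → IsBase M B → x ∈ B → x ∈ lookup P i → y ∈ B → y ∈ lookup P i → x ≡ y
  base-block-unique {B} i b x∈B x∈K y∈B y∈K =
    ∣p∣≡1⇒unique (base-meets-once B i b) (x∈p∩q⁺ (x∈B , x∈K)) (x∈p∩q⁺ (y∈B , y∈K))

  -- The new base must meet the block of x, which B - x does not.
  exchange-stays-in-block : ∀ {B x y} i → IsBase M B → x ∈ B → x ∈ lookup P i →
                            IsBase M ((B - x) ∪ ⁅ y ⁆) → y ∈ lookup P i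
  exchange-stays-in-block {B} {x} {y} i b x∈B x∈K b′
    with ∣p∣≡1⇒nonempty (base-meets-once _ i b′)
  ... | z , z∈B′∩K with x∈p∩q⁻ _ (lookup P i) z∈B′∩K
  ... | z∈B′ , z∈K with x∈p∪q⁻ (B - x) ⁅ y ⁆ z∈B′
  ... | inj₁ z∈B-x =
    contradiction (subst (_∈ ⁅ x ⁆) (base-block-unique i b x∈B x∈K (p─q⊆p B ⁅ x ⁆ z∈B-x) z∈K) (x∈⁅x⁆ x))
                  (x∈p─q⇒x∉q z∈B-x)
  ... | inj₂ z∈⁅y⁆ = subst (_∈ lookup P i) (x∈⁅y⁆⇒x≡y y z∈⁅y⁆) z∈K

  base⇒transversal : ∀ {B} → IsBase M B → IsTransversal P B
  base⇒transversal {B} b = (λ {x} x∈B → Equivalence.from (cover x) (B , b , x∈B)) , (λ i → base-meets-once B i b)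

  module _ {T} (transversal : IsTransversal P T) where

    base⊆transversal⇒≡ : ∀ {B} → IsBase M B → B ⊆ T → B ≡ T
    base⊆transversal⇒≡ {B} b B⊆T = ⊆-antisym B⊆T T⊆B
      where
      T⊆B : T ⊆ B
      T⊆B z∈T with proj₁ transversal z∈T
      ... | i , z∈K with ∣p∣≡1⇒nonempty (base-meets-once B i b)
      ... | y , y∈B∩K with x∈p∩q⁻ B (lookup P i) y∈B∩K
      ... | y∈B , y∈K =
        subst (_∈ B) (∣p∣≡1⇒unique (proj₂ transversal i) (x∈p∩q⁺ (B⊆T y∈B , y∈K)) (x∈p∩q⁺ (z∈T , z∈K))) y∈B

    -- t is the element of T in the block of x, and a base B₂ through t is the exchange partner.
    exchange-toward : ∀ {B x} → IsBase M B → x ∈ B → x ∉ T → ∃ λ t → t ∈ T × IsBase M ((B - x) ∪ ⁅ t ⁆)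
    exchange-toward {B} {x} b x∈B x∉T
      with Equivalence.from (cover x) (B , b , x∈B)
    ... | i , x∈K with ∣p∣≡1⇒nonempty (proj₂ transversal i)
    ... | t , t∈T∩K with x∈p∩q⁻ T (lookup P i) t∈T∩K
    ... | t∈T , t∈K with Equivalence.to (cover t) (i , t∈K)
    ... | B₂ , b₂ , t∈B₂
      with exchange M B B₂ b b₂ x x∈B
             (λ x∈B₂ → x∉T (subst (_∈ T) (base-block-unique i b₂ t∈B₂ t∈K x∈B₂ x∈K) t∈T))
    ... | y , y∈B₂ , _ , b′ =
      t , t∈T , subst (λ y → IsBase M ((B - x) ∪ ⁅ y ⁆)) y≡t b′
      where
      y≡t = base-block-unique i b₂ y∈B₂ (exchange-stays-in-block i b x∈B x∈K b′) t∈B₂ t∈K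

    descend : ∀ B → IsBase M B → Acc _<_ ∣ B ─ T ∣ → IsBase M T
    descend B b (acc smaller) with nonempty? (B ─ T)
    ... | no  B─T-empty = subst (IsBase M) (base⊆transversal⇒≡ b (Empty[p─q]⇒p⊆q B─T-empty)) b
    ... | yes (x , x∈B─T) with p─q⊆p B T x∈B─T | x∈p─q⇒x∉q x∈B─T
    ... | x∈B | x∉T with exchange-toward b x∈B x∉T
    ... | t , t∈T , b′ = descend _ b′ (smaller (p⊂q⇒∣p∣<∣q∣ (exchange─⊂ x∈B x∉T t∈T)))

    transversal⇒base : IsBase M T
    transversal⇒base = descend (proj₁ (nonempty M)) (proj₂ (nonempty M)) (<-wellFounded _)

  IsBase≐IsTransversal : IsBase M ≐ IsTransversal P
  IsBase≐IsTransversal = base⇒transversal , transversal⇒base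

All⇔∀lookup : ∀ {A : Set} {Q : Pred A 0ℓ} (xs : List A) → All Q xs ⇔ (∀ i → Q (lookup xs i))
All⇔∀lookup {Q = Q} xs = mk⇔
  (λ all → tabulate⁻ (subst (All Q) (sym (tabulate-lookup xs)) all))
  (λ Q[xs] → subst (All Q) (tabulate-lookup xs) (tabulate⁺ Q[xs]))

-- The points outside the blocks form one more block, which a transversal must avoid.
transversalConstraints : ∀ {n} → List (Subset n) → List (Constraint n)
transversalConstraints P = (∁ (⋃ P) , 0) ∷ map (_, 1) P

IsTransversal≐SatisfiesAll : ∀ {n} (P : List (Subset n)) → IsTransversal P ≐ SatisfiesAll (transversalConstraints P)
IsTransversal≐SatisfiesAll P =
  (λ (T⊆ , once) → Equivalence.from ∣p∩∁q∣≡0⇔p⊆q (Equivalence.from (∈⋃⇔∃lookup P) ∘ T⊆)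
                   ∷ All-map⁺ (Equivalence.from (All⇔∀lookup P) once)) ,
  (λ { (avoids ∷ once) → Equivalence.to (∈⋃⇔∃lookup P) ∘ Equivalence.to ∣p∩∁q∣≡0⇔p⊆q avoids
                        , Equivalence.to (All⇔∀lookup P) (All-map⁻ once) })

disjoint⇒ExactlyOne : ∀ {n} {P : List (Subset n)} → (∀ i j → i ≢ j → Empty (lookup P i ∩ lookup P j)) →
                      ∀ {x} i → x ∈ lookup P i → ExactlyOne (x ∈_) P
disjoint⇒ExactlyOne {P = K ∷ P} disjoint {x} zero x∈K =
  this x∈K (Equivalence.from (All⇔∀lookup P)
             λ j x∈Kj → disjoint zero (suc j) (λ ()) (x , x∈p∩q⁺ (x∈K , x∈Kj)))
disjoint⇒ExactlyOne {P = K ∷ P} disjoint {x} (suc i) x∈Ki =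
  next (λ x∈K → disjoint zero (suc i) (λ ()) (x , x∈p∩q⁺ (x∈K , x∈Ki)))
       (disjoint⇒ExactlyOne (λ i j i≢j → disjoint (suc i) (suc j) (i≢j ∘ Fin.suc-injective)) i x∈Ki)

transversalConstraints-isBlockPartition : ∀ {n} {P : List (Subset n)} →
  (∀ i j → i ≢ j → Empty (lookup P i ∩ lookup P j)) → IsBlockPartition (transversalConstraints P)
transversalConstraints-isBlockPartition {P = P} disjoint x with x ∈? ⋃ P
... | yes x∈⋃P = let i , x∈K = Equivalence.to (∈⋃⇔∃lookup P) x∈⋃P in
  next (x∈p⇒x∉∁p x∈⋃P) (ExactlyOne-map⁺ (_, 1) (disjoint⇒ExactlyOne disjoint i x∈K))
... | no  x∉⋃P = this (x∉p⇒x∈∁p x∉⋃P) (All-map⁺ (Equivalence.from (All⇔∀lookup P) x∉blocks))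
  where
  x∉blocks : ∀ i → x ∉ lookup P i
  x∉blocks i x∈K = x∉⋃P (Equivalence.from (∈⋃⇔∃lookup P) (i , x∈K))

product-weight-transversalConstraints : ∀ {n} (P : List (Subset n)) →
  product (map weight (transversalConstraints P)) ≡ product (map ∣_∣ P)
product-weight-transversalConstraints P = begin
  1 * product (map weight (map (_, 1) P)) ≡⟨ *-identityˡ _ ⟩
  product (map weight (map (_, 1) P))     ≡⟨ cong product (map-∘ P) ⟨
  product (map (λ K → ∣ K ∣ C 1) P)       ≡⟨ cong product (map-cong (nC1≡n ∘ ∣_∣) P) ⟩
  product (map ∣_∣ P)                     ∎

corollary3 : ∀ {n : ℕ} (M : Matroid n) (P : List (Subset n)) →
    IsPartitionOf (InUnionBases M) P →
    (∀ B i → IsBase M B → ∣ B ∩ lookup P i ∣ ≡ 1) →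
    numBases M ≡ product (map ∣_∣ P)
corollary3 M P (_ , disjoint , cover) base-meets-once = begin
  numBases M
    ≡⟨ numSubsetsWith-≐ _ (satisfiesAll? Q) bases≐satisfying ⟩
  numSubsetsWith (satisfiesAll? Q)
    ≡⟨ numSubsetsWith-satisfiesAll Q (transversalConstraints-isBlockPartition disjoint) ⟩
  product (map weight Q)
    ≡⟨ product-weight-transversalConstraints P ⟩
  product (map ∣_∣ P) ∎
  where
  Q = transversalConstraints P
  bases≐satisfying : IsBase M ≐ SatisfiesAll Q
  bases≐satisfying =
    let (base⇒tr , tr⇒base) = IsBase≐IsTransversal M P cover base-meets-once
        (tr⇒sat , sat⇒tr)   = IsTransversal≐SatisfiesAll P
    in tr⇒sat ∘ base⇒tr , tr⇒base ∘ sat⇒tr
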